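{- Let $E_8\subset\mathbb{R}^8$ be the root system of type $E_8$, normalized to unit vectors (240 points on $S^7$), and let $X$ be any subset containing exactly one vector from each antipodal pair (so $|X|=120$), with no assumption on the sum of $X$. Define relations on $X$ by $R_0=\{(x,x)\}$, $R_1=\{(x,y)\in X^2\mid\langle x,y\rangle=\tfrac12\}$, $R_2=\{(x,y)\in X^2\mid\langle x,y\rangle=0\}$, $R_3=\{(x,y)\in X^2\mid\langle x,y\rangle=-\tfrac12\}$. Then $(X,\{R_i\}_{0\le i\le 3})$ is not an association scheme (of class 3).
   Context: The inner products between distinct non-antipodal normalized $E_8$ roots lie in $\{\frac12,0,-\frac12\}$, so $R_0,\dots,R_3$ partition $X\times X$. An association scheme of class $d$ on $X$ is a partition of $X\times X$ into relations $R_0=\{(x,x)\},R_1,\dots,R_d$ such that each $R_i$ is closed under transposition (here automatically symmetric) and for all $i,j,k$ and all $(x,y)\in R_k$ the number $p_{ij}^k=|\{z\in X\mid (x,z)\in R_i,(z,y)\in R_j\}|$ depends only on $i,j,k$. -}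

module Defs where

open import Data.Nat using (ℕ; suc)
open import Data.Integer as ℤ using (ℤ; +_; -_; _+_; _*_)
open import Data.Integer.Divisibility using (_∣_)
open import Data.Fin using (Fin; zero; suc)
open import Data.Vec using (Vec; []; _∷_; foldr; zipWith; map)
open import Data.Vec.Relation.Unary.All using (All)
import Data.Vec.Properties as VecP
open import Data.List using (List; length; filter)
open import Data.List.Membership.Propositional using (_∈_)
open import Data.List.Relation.Unary.Unique.Propositional using (Unique)
open import Data.Product using (Σ; _×_; _,_)
open import Data.Sum using (_⊎_)
open import Relation.Nullary using (¬_; Dec)
open import Relation.Nullary.Decidable using (_×-dec_)
open import Relation.Binary.PropositionalEquality using (_≡_)

module _ {A : Set} (X : List A) (d : ℕ)
         (R : Fin (suc d) → A → A → Set)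
         (R? : ∀ i x y → Dec (R i x y)) where

  pcount : Fin (suc d) → Fin (suc d) → A → A → ℕ
  pcount i j x y = length (filter (λ z → R? i x z ×-dec R? j z y) X)

  record IsAssociationScheme : Set where
    field
      R₀-diag      : ∀ x y → x ∈ X → y ∈ X → (R zero x y → x ≡ y) × (x ≡ y → R zero x y)
      covers       : ∀ x y → x ∈ X → y ∈ X → Σ (Fin (suc d)) (λ i → R i x y)
      disjoint     : ∀ i j x y → x ∈ X → y ∈ X → R i x y → R j x y → i ≡ j
      transposed   : ∀ i → Σ (Fin (suc d)) (λ j → ∀ x y → x ∈ X → y ∈ X → R i x y → R j y x)
      intersection : ∀ i j k x y x' y' → x ∈ X → y ∈ X → x' ∈ X → y' ∈ X →
                     R k x y → R k x' y' → pcount i j x y ≡ pcount i j x' y'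

-- E8 in doubled coordinates: a vector v ∈ ℤ⁸ represents the E8 lattice
-- vector v/2 (even coordinate system: all coordinates in ℤ or all in ℤ+1/2,
-- coordinate sum even).  Roots are lattice vectors of squared norm 2,
-- i.e. doubled vectors with ⟨v,v⟩ = 8.  The normalized root is v/√8, so
-- the inner product of normalized roots u,v is dot u v / 8.

dot : ∀ {n} → Vec ℤ n → Vec ℤ n → ℤ
dot u v = foldr _ _+_ (+ 0) (zipWith _*_ u v)

neg : ∀ {n} → Vec ℤ n → Vec ℤ n
neg = map -_

IsE8Root : Vec ℤ 8 → Set
IsE8Root v =
  (All (λ c → (+ 2) ∣ c) v ⊎ All (λ c → ¬ ((+ 2) ∣ c)) v) ×
  ((+ 4) ∣ foldr _ _+_ (+ 0) v) ×
  (dot v v ≡ + 8)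

IsAntipodalHalf : List (Vec ℤ 8) → Set
IsAntipodalHalf X =
  Unique X ×
  (∀ v → v ∈ X → IsE8Root v) ×
  (∀ v → IsE8Root v → (v ∈ X ⊎ neg v ∈ X) × ¬ (v ∈ X × neg v ∈ X))

E8Rel : Fin 4 → Vec ℤ 8 → Vec ℤ 8 → Set
E8Rel zero x y = x ≡ y
E8Rel (suc zero) x y = dot x y ≡ + 4
E8Rel (suc (suc zero)) x y = dot x y ≡ + 0
E8Rel (suc (suc (suc zero))) x y = dot x y ≡ - (+ 4)

E8Rel? : ∀ i x y → Dec (E8Rel i x y)
E8Rel? zero x y = VecP.≡-dec ℤ._≟_ x y
E8Rel? (suc zero) x y = dot x y ℤ.≟ + 4
E8Rel? (suc (suc zero)) x y = dot x y ℤ.≟ + 0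
E8Rel? (suc (suc (suc zero))) x y = dot x y ℤ.≟ - (+ 4)

-- For x ∈ X let Φ x y = dot sₓ y, where sₓ is the sum of the z ∈ X with dot x z ≠ 0. On X × X,
-- dot is the combination 8A₀ + 4A₁ - 4A₃ of the adjacency matrices and sₓ is row x of
-- A₀ + A₁ + A₃, so in a scheme Φ x y depends only on the relation of (x, y). As Φ x is linear and
-- X contains one of ±r for every root r, Φ x takes one value up to sign on all roots whose
-- representative in X is in a given relation to x, and a sum u + v = w of such roots forces that
-- value to vanish. For x = ±(e₁+e₂) this gives Φ x x = 0 (through dot (∑ X) y, which equals Φ y y
-- on X) and Φ x r = 0 for the roots r orthogonal to e₁+e₂; then
-- 2(e₁+e₃) = (e₁+e₂) + (e₁-e₂) + (e₃+e₄) + (e₃-e₄) gives Φ x (e₁+e₃) = 0. But modulo 8 only the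
-- z with dot z (e₁+e₃) = ±4 contribute to Φ x (e₁+e₃), each 4, and they come from 29 antipodal
-- pairs, each meeting X once: Φ x (e₁+e₃) ≡ 4 (mod 8).

module Submission where

open import Defs
open import Data.Nat as ℕ using (ℕ; zero; suc)
open import Data.Integer as ℤ using (ℤ; +_; -[1+_]; -_; _+_; _*_; _-_; _◃_; 0ℤ; 1ℤ)
open import Data.Integer.Solver using (module +-*-Solver)
open +-*-Solver using (solve; _:=_; _:+_; _:-_; _:*_)
open import Data.Sign as Sign using (Sign)
open import Data.Vec using (Vec; []; _∷_; zipWith; foldr)
import Data.Vec.Properties as VecP
open import Data.Vec.Relation.Unary.All as VAll using ([]; _∷_) renaming (All to VAll)
import Data.Nat.Properties as ℕP
import Data.Nat.Divisibility as ℕD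
open import Data.Integer.Divisibility using () renaming (_∣_ to _∣ᵤ_)
import Data.Integer.Properties as ℤP
open import Data.Integer.Divisibility.Signed using (_∣_; _∣?_; divides; ∣m∣n⇒∣m+n)
open import Algebra.Properties.CommutativeSemigroup ℤP.+-commutativeSemigroup using () renaming (interchange to +-interchange)
open import Algebra.Properties.CommutativeSemigroup ℤP.*-commutativeSemigroup using () renaming (interchange to *-interchange)
open import Data.Bool using (true; false; if_then_else_)
open import Data.List using (List; []; _∷_; _++_; length; filter; allFin; cartesianProductWith)
open import Data.Fin as Fin using (Fin; zero; suc)
open import Data.List.Membership.Propositional.Properties using (∈-allFin; ∈-filter⁺; ∈-++⁺ˡ; ∈-++⁺ʳ; ∈-cartesianProductWith⁺)
open import Data.List.Relation.Unary.Unique.Propositional.Properties using (allFin⁺)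
open import Data.List.Relation.Unary.Any using (here; there)
open import Data.List.Relation.Unary.All as All using (All; []; _∷_; all?)
open import Data.List.Membership.Propositional using (_∈_; _∉_)
open import Data.List.Relation.Unary.Unique.Propositional using (Unique)
open import Data.List.Relation.Unary.AllPairs using ([]; _∷_)
open import Data.Product using (_×_; _,_; proj₁; proj₂; ∃-syntax)
open import Data.Sum using (_⊎_; inj₁; inj₂; [_,_]′)
open import Relation.Nullary using (¬_; Dec; yes; no; does)
open import Relation.Nullary.Decidable using (_×-dec_; _⊎-dec_; ¬?; from-yes; from-no)
open import Relation.Binary.Definitions using (DecidableEquality)
open import Relation.Binary.PropositionalEquality using (_≡_; _≢_; refl; sym; trans; cong; cong₂; subst; module ≡-Reasoning)
open ≡-Reasoning
open import Data.Empty using (⊥-elim)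
open import Function using (_∘_; id)

𝟙 : {P : Set} → Dec P → ℤ
𝟙 P? = if does P? then 1ℤ else 0ℤ

𝟙-yes : {P : Set} (P? : Dec P) → P → 𝟙 P? ≡ 1ℤ
𝟙-yes (yes _) _ = refl
𝟙-yes (no ¬p) p = ⊥-elim (¬p p)

𝟙-no : {P : Set} (P? : Dec P) → ¬ P → 𝟙 P? ≡ 0ℤ
𝟙-no (yes p) ¬p = ⊥-elim (¬p p)
𝟙-no (no _) _ = refl

𝟙-× : {P Q : Set} (P? : Dec P) (Q? : Dec Q) → 𝟙 (P? ×-dec Q?) ≡ 𝟙 P? * 𝟙 Q?
𝟙-× (yes _) (yes _) = refl
𝟙-× (yes _) (no _) = refl
𝟙-× (no _) _ = refl

∑ : {A : Set} → List A → (A → ℤ) → ℤ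
∑ [] f = 0ℤ
∑ (x ∷ xs) f = f x + ∑ xs f

module _ {A : Set} where

  ∑-cong : ∀ (xs : List A) {f g : A → ℤ} → (∀ {x} → x ∈ xs → f x ≡ g x) → ∑ xs f ≡ ∑ xs g
  ∑-cong [] f≗g = refl
  ∑-cong (x ∷ xs) f≗g = cong₂ _+_ (f≗g (here refl)) (∑-cong xs (f≗g ∘ there))

  ∑-zero : ∀ (xs : List A) → ∑ xs (λ _ → 0ℤ) ≡ 0ℤ
  ∑-zero [] = refl
  ∑-zero (x ∷ xs) = trans (ℤP.+-identityˡ _) (∑-zero xs)

  ∑-+ : ∀ (xs : List A) (f g : A → ℤ) → ∑ xs (λ x → f x + g x) ≡ ∑ xs f + ∑ xs g
  ∑-+ [] f g = refl
  ∑-+ (x ∷ xs) f g = trans (cong (_+_ (f x + g x)) (∑-+ xs f g)) (+-interchange (f x) (g x) (∑ xs f) (∑ xs g))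

  ∑-*ˡ : ∀ (xs : List A) c (f : A → ℤ) → ∑ xs (λ x → c * f x) ≡ c * ∑ xs f
  ∑-*ˡ [] c f = sym (ℤP.*-zeroʳ c)
  ∑-*ˡ (x ∷ xs) c f = trans (cong (_+_ (c * f x)) (∑-*ˡ xs c f)) (sym (ℤP.*-distribˡ-+ c (f x) (∑ xs f)))

  ∑-*ʳ : ∀ (xs : List A) c (f : A → ℤ) → ∑ xs (λ x → f x * c) ≡ ∑ xs f * c
  ∑-*ʳ [] c f = refl
  ∑-*ʳ (x ∷ xs) c f = trans (cong (_+_ (f x * c)) (∑-*ʳ xs c f)) (sym (ℤP.*-distribʳ-+ c (f x) (∑ xs f)))

  ∑-neg : ∀ (xs : List A) (f : A → ℤ) → ∑ xs (λ x → - f x) ≡ - ∑ xs f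
  ∑-neg [] f = refl
  ∑-neg (x ∷ xs) f = trans (cong (_+_ (- f x)) (∑-neg xs f)) (sym (ℤP.neg-distrib-+ (f x) (∑ xs f)))

  ∑-- : ∀ (xs : List A) (f g : A → ℤ) → ∑ xs (λ x → f x - g x) ≡ ∑ xs f - ∑ xs g
  ∑-- xs f g = trans (∑-+ xs f (λ x → - g x)) (cong (_+_ (∑ xs f)) (∑-neg xs g))

  ∑-𝟙≡length-filter : ∀ {P : A → Set} (P? : ∀ x → Dec (P x)) (xs : List A) → ∑ xs (λ x → 𝟙 (P? x)) ≡ + length (filter P? xs)
  ∑-𝟙≡length-filter P? [] = refl
  ∑-𝟙≡length-filter P? (x ∷ xs) with does (P? x)
  ... | true = cong (_+_ 1ℤ) (∑-𝟙≡length-filter P? xs)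
  ... | false = trans (ℤP.+-identityˡ _) (∑-𝟙≡length-filter P? xs)

  ∑-1≡length : ∀ (xs : List A) → ∑ xs (λ _ → 1ℤ) ≡ + length xs
  ∑-1≡length [] = refl
  ∑-1≡length (x ∷ xs) = cong (_+_ 1ℤ) (∑-1≡length xs)

  ∑-∣ : ∀ {k} (xs : List A) (f : A → ℤ) → (∀ {x} → x ∈ xs → k ∣ f x) → k ∣ ∑ xs f
  ∑-∣ {k} [] f _ = divides 0ℤ (sym (ℤP.*-zeroˡ k))
  ∑-∣ (x ∷ xs) f k∣f = ∣m∣n⇒∣m+n (k∣f (here refl)) (∑-∣ xs f (λ x∈ → k∣f (there x∈)))

  module _ (_≟_ : DecidableEquality A) where

    ∑-δ-∉ : ∀ (xs : List A) (f : A → ℤ) {y} → y ∉ xs → ∑ xs (λ x → f x * 𝟙 (y ≟ x)) ≡ 0ℤ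
    ∑-δ-∉ [] f y∉ = refl
    ∑-δ-∉ (x ∷ xs) f {y} y∉ = trans (cong₂ _+_ x-term (∑-δ-∉ xs f (y∉ ∘ there))) (ℤP.+-identityˡ _)
      where
      x-term : f x * 𝟙 (y ≟ x) ≡ 0ℤ
      x-term = trans (cong (f x *_) (𝟙-no (y ≟ x) (y∉ ∘ here))) (ℤP.*-zeroʳ (f x))

    ∑-δ : ∀ (xs : List A) (f : A → ℤ) {y} → Unique xs → y ∈ xs → ∑ xs (λ x → f x * 𝟙 (y ≟ x)) ≡ f y
    ∑-δ (x ∷ xs) f (x∉xs ∷ _) (here refl) =
      trans (cong₂ _+_ (trans (cong (f x *_) (𝟙-yes (x ≟ x) refl)) (ℤP.*-identityʳ (f x)))
                       (∑-δ-∉ xs f (λ x∈ → All.lookup x∉xs x∈ refl)))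
            (ℤP.+-identityʳ (f x))
    ∑-δ (x ∷ xs) f {y} (x∉xs ∷ u) (there y∈) =
      trans (cong₂ _+_ (trans (cong (f x *_) (𝟙-no (y ≟ x) λ { refl → All.lookup x∉xs y∈ refl })) (ℤP.*-zeroʳ (f x)))
                       (∑-δ xs f u y∈))
            (ℤP.+-identityˡ (f y))

    ∑-𝟙≟ : ∀ (xs : List A) {y} → Unique xs → y ∈ xs → ∑ xs (λ x → 𝟙 (y ≟ x)) ≡ 1ℤ
    ∑-𝟙≟ xs u y∈ = trans (∑-cong xs (λ _ → sym (ℤP.*-identityˡ _))) (∑-δ xs (λ _ → 1ℤ) u y∈)

    ∑-𝟙≟-∉ : ∀ (xs : List A) {y} → y ∉ xs → ∑ xs (λ x → 𝟙 (y ≟ x)) ≡ 0ℤ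
    ∑-𝟙≟-∉ xs y∉ = trans (∑-cong xs (λ _ → sym (ℤP.*-identityˡ _))) (∑-δ-∉ xs (λ _ → 1ℤ) y∉)

∑-comm : ∀ {A B : Set} (xs : List A) (ys : List B) (f : A → B → ℤ) →
         ∑ xs (λ x → ∑ ys (f x)) ≡ ∑ ys (λ y → ∑ xs (λ x → f x y))
∑-comm [] ys f = sym (∑-zero ys)
∑-comm (x ∷ xs) ys f =
  trans (cong (_+_ (∑ ys (f x))) (∑-comm xs ys f)) (sym (∑-+ ys (f x) (λ y → ∑ xs (λ x → f x y))))

∑-*-∑ : ∀ {A B : Set} (xs : List A) (ys : List B) (f : A → ℤ) (g : B → ℤ) →
        ∑ xs f * ∑ ys g ≡ ∑ xs (λ x → ∑ ys (λ y → f x * g y))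
∑-*-∑ xs ys f g = trans (sym (∑-*ʳ xs (∑ ys g) f)) (∑-cong xs (λ {x} _ → sym (∑-*ˡ ys (f x) g)))

-- The Bose–Mesner algebra of an association scheme

module BoseMesner {A : Set} {d : ℕ} {R : Fin (suc d) → A → A → Set} (R? : ∀ i x y → Dec (R i x y)) where

  ⟦_⟧ : (Fin (suc d) → ℤ) → A → A → ℤ
  ⟦ a ⟧ x y = ∑ (allFin (suc d)) λ i → a i * 𝟙 (R? i x y)

  ∑-𝟙*𝟙≡pcount : ∀ X i j x y → ∑ X (λ z → 𝟙 (R? i x z) * 𝟙 (R? j z y)) ≡ + pcount X d R R? i j x y
  ∑-𝟙*𝟙≡pcount X i j x y =
    trans (∑-cong X (λ {z} _ → sym (𝟙-× (R? i x z) (R? j z y))))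
          (∑-𝟙≡length-filter (λ z → R? i x z ×-dec R? j z y) X)

  ∑-⟦⟧*⟦⟧≡∑pcount : ∀ X a b x y →
    ∑ X (λ z → ⟦ a ⟧ x z * ⟦ b ⟧ z y) ≡
    ∑ (allFin (suc d)) λ i → ∑ (allFin (suc d)) λ j → a i * b j * + pcount X d R R? i j x y
  ∑-⟦⟧*⟦⟧≡∑pcount X a b x y = begin
    ∑ X (λ z → ⟦ a ⟧ x z * ⟦ b ⟧ z y)
      ≡⟨ ∑-cong X (λ {z} _ → ∑-*-∑ F F (λ i → a i * 𝟙 (R? i x z)) (λ j → b j * 𝟙 (R? j z y))) ⟩
    ∑ X (λ z → ∑ F λ i → ∑ F λ j → term i j z)
      ≡⟨ ∑-comm X F _ ⟩
    ∑ F (λ i → ∑ X λ z → ∑ F λ j → term i j z)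
      ≡⟨ ∑-cong F (λ {i} _ → ∑-comm X F (λ z j → term i j z)) ⟩
    ∑ F (λ i → ∑ F λ j → ∑ X λ z → term i j z)
      ≡⟨ ∑-cong F (λ {i} _ → ∑-cong F (λ {j} _ → ∑-term≡pcount i j)) ⟩
    ∑ F (λ i → ∑ F λ j → a i * b j * + pcount X d R R? i j x y) ∎
    where
    F : List (Fin (suc d))
    F = allFin (suc d)
    term : Fin (suc d) → Fin (suc d) → A → ℤ
    term i j z = (a i * 𝟙 (R? i x z)) * (b j * 𝟙 (R? j z y))
    ∑-term≡pcount : ∀ i j → ∑ X (term i j) ≡ a i * b j * + pcount X d R R? i j x y
    ∑-term≡pcount i j = begin
      ∑ X (term i j)
        ≡⟨ ∑-cong X (λ {z} _ → *-interchange (a i) (𝟙 (R? i x z)) (b j) (𝟙 (R? j z y))) ⟩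
      ∑ X (λ z → a i * b j * (𝟙 (R? i x z) * 𝟙 (R? j z y)))
        ≡⟨ ∑-*ˡ X (a i * b j) _ ⟩
      a i * b j * ∑ X (λ z → 𝟙 (R? i x z) * 𝟙 (R? j z y))
        ≡⟨ cong (a i * b j *_) (∑-𝟙*𝟙≡pcount X i j x y) ⟩
      a i * b j * + pcount X d R R? i j x y ∎

  module _ {X : List A} (scheme : IsAssociationScheme X d R R?) where
    open IsAssociationScheme scheme

    ⟦⟧-on-relation : ∀ a {i x y} → x ∈ X → y ∈ X → R i x y → ⟦ a ⟧ x y ≡ a i
    ⟦⟧-on-relation a {i} {x} {y} x∈ y∈ Rixy =
      trans (∑-cong (allFin (suc d)) (λ {j} _ → cong (a j *_) (𝟙-relation j)))
            (∑-δ Fin._≟_ (allFin (suc d)) a (allFin⁺ (suc d)) (∈-allFin i))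
      where
      𝟙-relation : ∀ j → 𝟙 (R? j x y) ≡ 𝟙 (i Fin.≟ j)
      𝟙-relation j with R? j x y
      ... | yes Rjxy = sym (𝟙-yes (i Fin.≟ j) (disjoint i j x y x∈ y∈ Rixy Rjxy))
      ... | no ¬Rjxy = sym (𝟙-no (i Fin.≟ j) λ { refl → ¬Rjxy Rixy })

    ∑-⟦⟧*⟦⟧-invariant : ∀ a b {k x y x′ y′} → x ∈ X → y ∈ X → x′ ∈ X → y′ ∈ X → R k x y → R k x′ y′ →
                        ∑ X (λ z → ⟦ a ⟧ x z * ⟦ b ⟧ z y) ≡ ∑ X (λ z → ⟦ a ⟧ x′ z * ⟦ b ⟧ z y′)
    ∑-⟦⟧*⟦⟧-invariant a b {k} {x} {y} {x′} {y′} x∈ y∈ x′∈ y′∈ Rxy Rx′y′ = begin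
      ∑ X (λ z → ⟦ a ⟧ x z * ⟦ b ⟧ z y)
        ≡⟨ ∑-⟦⟧*⟦⟧≡∑pcount X a b x y ⟩
      ∑ F (λ i → ∑ F λ j → a i * b j * + pcount X d R R? i j x y)
        ≡⟨ ∑-cong F (λ {i} _ → ∑-cong F (λ {j} _ →
             cong (λ p → a i * b j * + p) (intersection i j k x y x′ y′ x∈ y∈ x′∈ y′∈ Rxy Rx′y′))) ⟩
      ∑ F (λ i → ∑ F λ j → a i * b j * + pcount X d R R? i j x′ y′)
        ≡⟨ ∑-⟦⟧*⟦⟧≡∑pcount X a b x′ y′ ⟨
      ∑ X (λ z → ⟦ a ⟧ x′ z * ⟦ b ⟧ z y′) ∎
      where
      F : List (Fin (suc d))
      F = allFin (suc d)

_+ᵥ_ : ∀ {n} → Vec ℤ n → Vec ℤ n → Vec ℤ n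
_+ᵥ_ = zipWith _+_

dot-comm : ∀ {n} (u v : Vec ℤ n) → dot u v ≡ dot v u
dot-comm [] [] = refl
dot-comm (a ∷ u) (b ∷ v) = cong₂ _+_ (ℤP.*-comm a b) (dot-comm u v)

dot-+ʳ : ∀ {n} (z u v : Vec ℤ n) → dot z (u +ᵥ v) ≡ dot z u + dot z v
dot-+ʳ [] [] [] = refl
dot-+ʳ (c ∷ z) (a ∷ u) (b ∷ v) =
  trans (cong₂ _+_ (ℤP.*-distribˡ-+ c a b) (dot-+ʳ z u v)) (+-interchange (c * a) (c * b) (dot z u) (dot z v))

dot-negʳ : ∀ {n} (z u : Vec ℤ n) → dot z (neg u) ≡ - dot z u
dot-negʳ [] [] = refl
dot-negʳ (c ∷ z) (a ∷ u) =
  trans (cong₂ _+_ (sym (ℤP.neg-distribʳ-* c a)) (dot-negʳ z u)) (sym (ℤP.neg-distrib-+ (c * a) (dot z u)))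

dot-negˡ : ∀ {n} (u z : Vec ℤ n) → dot (neg u) z ≡ - dot u z
dot-negˡ u z = trans (dot-comm (neg u) z) (trans (dot-negʳ z u) (cong -_ (dot-comm z u)))

neg-involutive : ∀ {n} (v : Vec ℤ n) → neg (neg v) ≡ v
neg-involutive [] = refl
neg-involutive (a ∷ v) = cong₂ _∷_ (ℤP.neg-involutive a) (neg-involutive v)

signed : Sign → ℤ → ℤ
signed Sign.+ a = a
signed Sign.- a = - a

signedᵥ : ∀ {n} → Sign → Vec ℤ n → Vec ℤ n
signedᵥ Sign.+ v = v
signedᵥ Sign.- v = neg v

signedᵥ-involutive : ∀ {n} s (v : Vec ℤ n) → signedᵥ s (signedᵥ s v) ≡ v
signedᵥ-involutive Sign.+ v = refl
signedᵥ-involutive Sign.- v = neg-involutive v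

signed-zero : ∀ s → signed s 0ℤ ≡ 0ℤ
signed-zero Sign.+ = refl
signed-zero Sign.- = refl

signed≡0 : ∀ s {a} → signed s a ≡ 0ℤ → a ≡ 0ℤ
signed≡0 Sign.+ a≡0 = a≡0
signed≡0 Sign.- {a} -a≡0 = trans (sym (ℤP.neg-involutive a)) (cong -_ -a≡0)

signed≡◃1* : ∀ s a → signed s a ≡ (s ◃ 1) * a
signed≡◃1* Sign.+ a = sym (ℤP.*-identityˡ a)
signed≡◃1* Sign.- a = sym (ℤP.-1*i≡-i a)

sign-sum≢0 : ∀ s₁ s₂ s₃ → (s₁ ◃ 1) + (s₂ ◃ 1) - (s₃ ◃ 1) ≢ 0ℤ
sign-sum≢0 Sign.+ Sign.+ Sign.+ ()
sign-sum≢0 Sign.+ Sign.+ Sign.- ()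
sign-sum≢0 Sign.+ Sign.- Sign.+ ()
sign-sum≢0 Sign.+ Sign.- Sign.- ()
sign-sum≢0 Sign.- Sign.+ Sign.+ ()
sign-sum≢0 Sign.- Sign.+ Sign.- ()
sign-sum≢0 Sign.- Sign.- Sign.+ ()
sign-sum≢0 Sign.- Sign.- Sign.- ()

signed-sum≡signed⇒0 : ∀ s₁ s₂ s₃ {c} → signed s₁ c + signed s₂ c ≡ signed s₃ c → c ≡ 0ℤ
signed-sum≡signed⇒0 s₁ s₂ s₃ {c} eq =
  [ ⊥-elim ∘ sign-sum≢0 s₁ s₂ s₃ , id ]′ (ℤP.i*j≡0⇒i≡0∨j≡0 (a₁ + a₂ - a₃) (begin
    (a₁ + a₂ - a₃) * c                        ≡⟨ solve 4 (λ a₁ a₂ a₃ c → (a₁ :+ a₂ :- a₃) :* c := a₁ :* c :+ a₂ :* c :- a₃ :* c)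
                                                          refl a₁ a₂ a₃ c ⟩
    a₁ * c + a₂ * c - a₃ * c                  ≡⟨ cong₂ _-_ (cong₂ _+_ (signed≡◃1* s₁ c) (signed≡◃1* s₂ c)) (signed≡◃1* s₃ c) ⟨
    signed s₁ c + signed s₂ c - signed s₃ c   ≡⟨ cong (_- signed s₃ c) eq ⟩
    signed s₃ c - signed s₃ c                 ≡⟨ ℤP.+-inverseʳ (signed s₃ c) ⟩
    0ℤ                                        ∎))
  where
  a₁ a₂ a₃ : ℤ
  a₁ = s₁ ◃ 1
  a₂ = s₂ ◃ 1
  a₃ = s₃ ◃ 1

double≡0 : ∀ {a} → a + a ≡ 0ℤ → a ≡ 0ℤ
double≡0 {a} a+a≡0 = ℤP.*-cancelˡ-≡ (+ 2) a 0ℤ (begin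
  + 2 * a            ≡⟨ ℤP.*-distribʳ-+ a 1ℤ 1ℤ ⟩
  1ℤ * a + 1ℤ * a    ≡⟨ cong₂ _+_ (ℤP.*-identityˡ a) (ℤP.*-identityˡ a) ⟩
  a + a              ≡⟨ a+a≡0 ⟩
  0ℤ                 ∎)

dot-signed-⊥ : ∀ {n} s t {u v : Vec ℤ n} → dot u v ≡ 0ℤ → dot (signedᵥ s u) (signedᵥ t v) ≡ 0ℤ
dot-signed-⊥ Sign.+ Sign.+ u⊥v = u⊥v
dot-signed-⊥ Sign.+ Sign.- {u} {v} u⊥v = trans (dot-negʳ u v) (cong -_ u⊥v)
dot-signed-⊥ Sign.- Sign.+ {u} {v} u⊥v = trans (dot-negˡ u v) (cong -_ u⊥v)
dot-signed-⊥ Sign.- Sign.- {u} {v} u⊥v = trans (dot-negˡ u (neg v)) (cong -_ (trans (dot-negʳ u v) (cong -_ u⊥v)))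

module OddAdditive {n} (f : Vec ℤ n → ℤ) (f-+ : ∀ u v → f (u +ᵥ v) ≡ f u + f v) (f-neg : ∀ u → f (neg u) ≡ - f u) where

  f-signed : ∀ s u → f (signedᵥ s u) ≡ signed s (f u)
  f-signed Sign.+ u = refl
  f-signed Sign.- u = f-neg u

  signed-constant-on-sum⇒0 : ∀ s₁ s₂ s₃ {u v c} →
    f (signedᵥ s₁ u) ≡ c → f (signedᵥ s₂ v) ≡ c → f (signedᵥ s₃ (u +ᵥ v)) ≡ c → c ≡ 0ℤ
  signed-constant-on-sum⇒0 s₁ s₂ s₃ {u} {v} {c} fu fv fw = signed-sum≡signed⇒0 s₁ s₂ s₃ (begin
    signed s₁ c + signed s₂ c           ≡⟨ cong₂ _+_ (recover s₁ fu) (recover s₂ fv) ⟨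
    f u + f v                           ≡⟨ f-+ u v ⟨
    f (u +ᵥ v)                          ≡⟨ recover s₃ fw ⟩
    signed s₃ c                         ∎)
    where
    recover : ∀ s {w} → f (signedᵥ s w) ≡ c → f w ≡ signed s c
    recover s {w} fsw = begin
      f w                               ≡⟨ cong f (signedᵥ-involutive s w) ⟨
      f (signedᵥ s (signedᵥ s w))       ≡⟨ f-signed s (signedᵥ s w) ⟩
      signed s (f (signedᵥ s w))        ≡⟨ cong (signed s) fsw ⟩
      signed s c                        ∎

-- The roots of E₈

ℤ⁸ : Set
ℤ⁸ = Vec ℤ 8

_≟ᵥ_ : DecidableEquality ℤ⁸
_≟ᵥ_ = VecP.≡-dec ℤ._≟_

coordinateSum : ∀ {n} → Vec ℤ n → ℤ
coordinateSum = foldr _ _+_ 0ℤ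

norm≡8? : (v : ℤ⁸) → Dec (dot v v ≡ + 8)
norm≡8? v = dot v v ℤ.≟ + 8

4∣sum? : (v : ℤ⁸) → Dec ((+ 4) ∣ᵤ coordinateSum v)
4∣sum? v = 4 ℕD.∣? ℤ.∣ coordinateSum v ∣

isE8Root? : (v : ℤ⁸) → Dec (IsE8Root v)
isE8Root? v =
  (VAll.all? (λ c → 2 ℕD.∣? ℤ.∣ c ∣) v ⊎-dec VAll.all? (λ c → ¬? (2 ℕD.∣? ℤ.∣ c ∣)) v)
  ×-dec 4∣sum? v ×-dec norm≡8? v

vectorsOver : {A : Set} → List A → (n : ℕ) → List (Vec A n)
vectorsOver xs zero = [] ∷ []
vectorsOver xs (suc n) = cartesianProductWith _∷_ xs (vectorsOver xs n)

∈-vectorsOver : ∀ {A : Set} {xs : List A} {n} {v : Vec A n} → VAll (_∈ xs) v → v ∈ vectorsOver xs n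
∈-vectorsOver [] = here refl
∈-vectorsOver (c∈ ∷ v∈) = ∈-cartesianProductWith⁺ _∷_ c∈ (∈-vectorsOver v∈)

evenCoordinates oddCoordinates : List ℤ
evenCoordinates = + 0 ∷ + 2 ∷ - + 2 ∷ []
oddCoordinates = + 1 ∷ - + 1 ∷ []

integralRoots halfIntegralRoots roots : List ℤ⁸
integralRoots = filter norm≡8? (vectorsOver evenCoordinates 8)
halfIntegralRoots = filter 4∣sum? (vectorsOver oddCoordinates 8)
roots = integralRoots ++ halfIntegralRoots

sumOfSquares : ∀ {n} → Vec ℤ n → ℕ
sumOfSquares [] = 0
sumOfSquares (c ∷ v) = ℤ.∣ c ∣ ℕ.* ℤ.∣ c ∣ ℕ.+ sumOfSquares v

dot-self : ∀ {n} (v : Vec ℤ n) → dot v v ≡ + sumOfSquares v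
dot-self [] = refl
dot-self (c ∷ v) = cong₂ _+_ (square c) (dot-self v)
  where
  square : ∀ c → c * c ≡ + (ℤ.∣ c ∣ ℕ.* ℤ.∣ c ∣)
  square (+ n) = ℤP.+◃n≡+n (n ℕ.* n)
  square -[1+ n ] = refl

square≤8⇒≤2 : ∀ n → n ℕ.* n ℕ.≤ 8 → n ℕ.≤ 2
square≤8⇒≤2 n n²≤8 with n ℕ.≤? 2
... | yes n≤2 = n≤2
... | no n≰2 = ⊥-elim (ℕP.<-irrefl refl (ℕP.≤-trans (ℕP.*-mono-≤ 3≤n 3≤n) n²≤8))
  where
  3≤n : 3 ℕ.≤ n
  3≤n = ℕP.≰⇒> n≰2

sumOfSquares≤8⇒coordinates≤2 : ∀ {n} (v : Vec ℤ n) → sumOfSquares v ℕ.≤ 8 → VAll (λ c → ℤ.∣ c ∣ ℕ.≤ 2) v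
sumOfSquares≤8⇒coordinates≤2 [] _ = []
sumOfSquares≤8⇒coordinates≤2 (c ∷ v) ≤8 =
  square≤8⇒≤2 ℤ.∣ c ∣ (ℕP.m+n≤o⇒m≤o _ ≤8) ∷ sumOfSquares≤8⇒coordinates≤2 v (ℕP.m+n≤o⇒n≤o (ℤ.∣ c ∣ ℕ.* ℤ.∣ c ∣) ≤8)

norm≡8⇒coordinates≤2 : ∀ {n} {v : Vec ℤ n} → dot v v ≡ + 8 → VAll (λ c → ℤ.∣ c ∣ ℕ.≤ 2) v
norm≡8⇒coordinates≤2 {v = v} norm =
  sumOfSquares≤8⇒coordinates≤2 v (ℕP.≤-reflexive (ℤP.+-injective (trans (sym (dot-self v)) norm)))

even-coordinate : ∀ {c} → ℤ.∣ c ∣ ℕ.≤ 2 × (+ 2) ∣ᵤ c → c ∈ evenCoordinates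
even-coordinate {+ 0} _ = here refl
even-coordinate {+ 1} (_ , 2∣1) = ⊥-elim (ℕP.<-irrefl refl (ℕD.∣⇒≤ 2∣1))
even-coordinate {+ 2} _ = there (here refl)
even-coordinate { -[1+ 0 ]} (_ , 2∣1) = ⊥-elim (ℕP.<-irrefl refl (ℕD.∣⇒≤ 2∣1))
even-coordinate { -[1+ 1 ]} _ = there (there (here refl))
even-coordinate {+ suc (suc (suc _))} (ℕ.s≤s (ℕ.s≤s ()) , _)
even-coordinate { -[1+ suc (suc _) ]} (ℕ.s≤s (ℕ.s≤s ()) , _)

odd-coordinate : ∀ {c} → ℤ.∣ c ∣ ℕ.≤ 2 × ¬ (+ 2) ∣ᵤ c → c ∈ oddCoordinates
odd-coordinate {+ 0} (_ , 2∤0) = ⊥-elim (2∤0 (2 ℕD.∣0))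
odd-coordinate {+ 1} _ = here refl
odd-coordinate {+ 2} (_ , 2∤2) = ⊥-elim (2∤2 ℕD.∣-refl)
odd-coordinate { -[1+ 0 ]} _ = there (here refl)
odd-coordinate { -[1+ 1 ]} (_ , 2∤2) = ⊥-elim (2∤2 ℕD.∣-refl)
odd-coordinate {+ suc (suc (suc _))} (ℕ.s≤s (ℕ.s≤s ()) , _)
odd-coordinate { -[1+ suc (suc _) ]} (ℕ.s≤s (ℕ.s≤s ()) , _)

∈-roots : ∀ {v} → IsE8Root v → v ∈ roots
∈-roots (inj₁ even , _ , norm) =
  ∈-++⁺ˡ (∈-filter⁺ norm≡8? (∈-vectorsOver (VAll.map even-coordinate (VAll.zip (norm≡8⇒coordinates≤2 norm , even)))) norm)
∈-roots (inj₂ odd , 4∣sum , norm) =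
  ∈-++⁺ʳ integralRoots
    (∈-filter⁺ 4∣sum? (∈-vectorsOver (VAll.map odd-coordinate (VAll.zip (norm≡8⇒coordinates≤2 norm , odd)))) 4∣sum)

gram : Fin 4 → ℤ
gram zero = + 8
gram (suc zero) = + 4
gram (suc (suc zero)) = 0ℤ
gram (suc (suc (suc zero))) = - + 4

nonOrthogonal : Fin 4 → ℤ
nonOrthogonal zero = 1ℤ
nonOrthogonal (suc zero) = 1ℤ
nonOrthogonal (suc (suc zero)) = 0ℤ
nonOrthogonal (suc (suc (suc zero))) = 1ℤ

open BoseMesner E8Rel?

e₁+e₂ e₁-e₂ e₁+e₃ e₃+e₄ e₃-e₄ e₅-e₃ e₄+e₅ : ℤ⁸
e₁+e₂ = + 2 ∷ + 2 ∷ + 0 ∷ + 0 ∷ + 0 ∷ + 0 ∷ + 0 ∷ + 0 ∷ []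
e₁-e₂ = + 2 ∷ - + 2 ∷ + 0 ∷ + 0 ∷ + 0 ∷ + 0 ∷ + 0 ∷ + 0 ∷ []
e₁+e₃ = + 2 ∷ + 0 ∷ + 2 ∷ + 0 ∷ + 0 ∷ + 0 ∷ + 0 ∷ + 0 ∷ []
e₃+e₄ = + 0 ∷ + 0 ∷ + 2 ∷ + 2 ∷ + 0 ∷ + 0 ∷ + 0 ∷ + 0 ∷ []
e₃-e₄ = + 0 ∷ + 0 ∷ + 2 ∷ - + 2 ∷ + 0 ∷ + 0 ∷ + 0 ∷ + 0 ∷ []
e₅-e₃ = + 0 ∷ + 0 ∷ - + 2 ∷ + 0 ∷ + 2 ∷ + 0 ∷ + 0 ∷ + 0 ∷ []
e₄+e₅ = + 0 ∷ + 0 ∷ + 0 ∷ + 2 ∷ + 2 ∷ + 0 ∷ + 0 ∷ + 0 ∷ []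

antipodalMultiplicity : List ℤ⁸ → ℤ⁸ → ℤ
antipodalMultiplicity L z = ∑ L λ p → 𝟙 (p ≟ᵥ z) + 𝟙 (neg p ≟ᵥ z)

-- One root from each antipodal pair {z, -z} with dot (e₁+e₂) z ≠ 0 and dot (e₁+e₃) z = ±4.
contributingPairs : List ℤ⁸
contributingPairs =
  (+ 0 ∷ + 2 ∷ + 2 ∷ + 0 ∷ + 0 ∷ + 0 ∷ + 0 ∷ + 0 ∷ [])
  ∷ (+ 0 ∷ + 2 ∷ - + 2 ∷ + 0 ∷ + 0 ∷ + 0 ∷ + 0 ∷ + 0 ∷ [])
  ∷ (+ 2 ∷ + 0 ∷ + 0 ∷ + 0 ∷ + 0 ∷ + 0 ∷ + 0 ∷ + 2 ∷ [])
  ∷ (+ 2 ∷ + 0 ∷ + 0 ∷ + 0 ∷ + 0 ∷ + 0 ∷ + 0 ∷ - + 2 ∷ [])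
  ∷ (+ 2 ∷ + 0 ∷ + 0 ∷ + 0 ∷ + 0 ∷ + 0 ∷ + 2 ∷ + 0 ∷ [])
  ∷ (+ 2 ∷ + 0 ∷ + 0 ∷ + 0 ∷ + 0 ∷ + 0 ∷ - + 2 ∷ + 0 ∷ [])
  ∷ (+ 2 ∷ + 0 ∷ + 0 ∷ + 0 ∷ + 0 ∷ + 2 ∷ + 0 ∷ + 0 ∷ [])
  ∷ (+ 2 ∷ + 0 ∷ + 0 ∷ + 0 ∷ + 0 ∷ - + 2 ∷ + 0 ∷ + 0 ∷ [])
  ∷ (+ 2 ∷ + 0 ∷ + 0 ∷ + 0 ∷ + 2 ∷ + 0 ∷ + 0 ∷ + 0 ∷ [])
  ∷ (+ 2 ∷ + 0 ∷ + 0 ∷ + 0 ∷ - + 2 ∷ + 0 ∷ + 0 ∷ + 0 ∷ [])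
  ∷ (+ 2 ∷ + 0 ∷ + 0 ∷ + 2 ∷ + 0 ∷ + 0 ∷ + 0 ∷ + 0 ∷ [])
  ∷ (+ 2 ∷ + 0 ∷ + 0 ∷ - + 2 ∷ + 0 ∷ + 0 ∷ + 0 ∷ + 0 ∷ [])
  ∷ (+ 2 ∷ + 2 ∷ + 0 ∷ + 0 ∷ + 0 ∷ + 0 ∷ + 0 ∷ + 0 ∷ [])
  ∷ (+ 1 ∷ + 1 ∷ + 1 ∷ + 1 ∷ + 1 ∷ + 1 ∷ + 1 ∷ + 1 ∷ [])
  ∷ (+ 1 ∷ + 1 ∷ + 1 ∷ + 1 ∷ + 1 ∷ + 1 ∷ - + 1 ∷ - + 1 ∷ [])
  ∷ (+ 1 ∷ + 1 ∷ + 1 ∷ + 1 ∷ + 1 ∷ - + 1 ∷ + 1 ∷ - + 1 ∷ [])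
  ∷ (+ 1 ∷ + 1 ∷ + 1 ∷ + 1 ∷ + 1 ∷ - + 1 ∷ - + 1 ∷ + 1 ∷ [])
  ∷ (+ 1 ∷ + 1 ∷ + 1 ∷ + 1 ∷ - + 1 ∷ + 1 ∷ + 1 ∷ - + 1 ∷ [])
  ∷ (+ 1 ∷ + 1 ∷ + 1 ∷ + 1 ∷ - + 1 ∷ + 1 ∷ - + 1 ∷ + 1 ∷ [])
  ∷ (+ 1 ∷ + 1 ∷ + 1 ∷ + 1 ∷ - + 1 ∷ - + 1 ∷ + 1 ∷ + 1 ∷ [])
  ∷ (+ 1 ∷ + 1 ∷ + 1 ∷ + 1 ∷ - + 1 ∷ - + 1 ∷ - + 1 ∷ - + 1 ∷ [])
  ∷ (+ 1 ∷ + 1 ∷ + 1 ∷ - + 1 ∷ + 1 ∷ + 1 ∷ + 1 ∷ - + 1 ∷ [])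
  ∷ (+ 1 ∷ + 1 ∷ + 1 ∷ - + 1 ∷ + 1 ∷ + 1 ∷ - + 1 ∷ + 1 ∷ [])
  ∷ (+ 1 ∷ + 1 ∷ + 1 ∷ - + 1 ∷ + 1 ∷ - + 1 ∷ + 1 ∷ + 1 ∷ [])
  ∷ (+ 1 ∷ + 1 ∷ + 1 ∷ - + 1 ∷ + 1 ∷ - + 1 ∷ - + 1 ∷ - + 1 ∷ [])
  ∷ (+ 1 ∷ + 1 ∷ + 1 ∷ - + 1 ∷ - + 1 ∷ + 1 ∷ + 1 ∷ + 1 ∷ [])
  ∷ (+ 1 ∷ + 1 ∷ + 1 ∷ - + 1 ∷ - + 1 ∷ + 1 ∷ - + 1 ∷ - + 1 ∷ [])
  ∷ (+ 1 ∷ + 1 ∷ + 1 ∷ - + 1 ∷ - + 1 ∷ - + 1 ∷ + 1 ∷ - + 1 ∷ [])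
  ∷ (+ 1 ∷ + 1 ∷ + 1 ∷ - + 1 ∷ - + 1 ∷ - + 1 ∷ - + 1 ∷ + 1 ∷ [])
  ∷ []

-- The congruence fails at z = -x, which however never lies in X together with x.
Congruent : ℤ⁸ → ℤ⁸ → Set
Congruent x z = z ≡ neg x ⊎ + 8 ∣ ⟦ nonOrthogonal ⟧ x z * dot z e₁+e₃ - + 4 * antipodalMultiplicity contributingPairs z

congruent? : ∀ x z → Dec (Congruent x z)
congruent? x z =
  (z ≟ᵥ neg x) ⊎-dec (+ 8 ∣? ⟦ nonOrthogonal ⟧ x z * dot z e₁+e₃ - + 4 * antipodalMultiplicity contributingPairs z)

congruent-on-roots : ∀ s → All (Congruent (signedᵥ s e₁+e₂)) roots
congruent-on-roots Sign.+ = from-yes (all? (congruent? e₁+e₂) roots)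
congruent-on-roots Sign.- = from-yes (all? (congruent? (neg e₁+e₂)) roots)

-- An association scheme on an antipodal half of E₈

module Consequences (X : List ℤ⁸) (antipodalHalf : IsAntipodalHalf X)
                    (scheme : IsAssociationScheme X 3 E8Rel E8Rel?) where

  open IsAssociationScheme scheme using (covers)

  X-unique : Unique X
  X-unique = proj₁ antipodalHalf

  X-roots : ∀ {v} → v ∈ X → IsE8Root v
  X-roots {v} = proj₁ (proj₂ antipodalHalf) v

  one-of-±-in-X : ∀ {r} → IsE8Root r → (r ∈ X ⊎ neg r ∈ X) × ¬ (r ∈ X × neg r ∈ X)
  one-of-±-in-X {r} = proj₂ (proj₂ antipodalHalf) r

  neg∉X : ∀ {y} → y ∈ X → neg y ∉ X
  neg∉X y∈ -y∈ = proj₂ (one-of-±-in-X (X-roots y∈)) (y∈ , -y∈)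

  representative : ∀ {r} → IsE8Root r → ∃[ s ] signedᵥ s r ∈ X
  representative r-root with proj₁ (one-of-±-in-X r-root)
  ... | inj₁ r∈ = Sign.+ , r∈
  ... | inj₂ -r∈ = Sign.- , -r∈

  antipodal-pair-meets-X-once : ∀ {p} → IsE8Root p → ∑ X (λ z → 𝟙 (p ≟ᵥ z) + 𝟙 (neg p ≟ᵥ z)) ≡ 1ℤ
  antipodal-pair-meets-X-once {p} p-root with proj₁ (one-of-±-in-X p-root)
  ... | inj₁ p∈ = trans (∑-+ X _ _) (cong₂ _+_ (∑-𝟙≟ _≟ᵥ_ X X-unique p∈) (∑-𝟙≟-∉ _≟ᵥ_ X (neg∉X p∈)))
  ... | inj₂ -p∈ = trans (∑-+ X _ _) (cong₂ _+_ (∑-𝟙≟-∉ _≟ᵥ_ X p∉) (∑-𝟙≟ _≟ᵥ_ X X-unique -p∈))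
    where
    p∉ : p ∉ X
    p∉ = subst (_∉ X) (neg-involutive p) (neg∉X -p∈)

  ∑-antipodalMultiplicity : ∀ {L} → All IsE8Root L → ∑ X (antipodalMultiplicity L) ≡ + length L
  ∑-antipodalMultiplicity {L} L-roots = begin
    ∑ X (antipodalMultiplicity L)                           ≡⟨ ∑-comm X L _ ⟩
    ∑ L (λ p → ∑ X (λ z → 𝟙 (p ≟ᵥ z) + 𝟙 (neg p ≟ᵥ z)))     ≡⟨ ∑-cong L (antipodal-pair-meets-X-once ∘ All.lookup L-roots) ⟩
    ∑ L (λ _ → 1ℤ)                                          ≡⟨ ∑-1≡length L ⟩
    + length L                                              ∎

  dot≡⟦gram⟧ : ∀ {y z} → y ∈ X → z ∈ X → dot z y ≡ ⟦ gram ⟧ z y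
  dot≡⟦gram⟧ {y} {z} y∈ z∈ with covers z y z∈ y∈
  ... | i , Rzy = trans (dot-on-relation i Rzy) (sym (⟦⟧-on-relation scheme gram z∈ y∈ Rzy))
    where
    dot-on-relation : ∀ i → E8Rel i z y → dot z y ≡ gram i
    dot-on-relation zero refl = proj₂ (proj₂ (X-roots y∈))
    dot-on-relation (suc zero) eq = eq
    dot-on-relation (suc (suc zero)) eq = eq
    dot-on-relation (suc (suc (suc zero))) eq = eq

  dot≡⟦nonOrthogonal⟧*dot : ∀ {x z} → x ∈ X → z ∈ X → dot z x ≡ ⟦ nonOrthogonal ⟧ x z * dot z x
  dot≡⟦nonOrthogonal⟧*dot {x} {z} x∈ z∈ with covers x z x∈ z∈
  ... | i , Rxz =
    trans (sym (weight-on-relation i Rxz)) (cong (_* dot z x) (sym (⟦⟧-on-relation scheme nonOrthogonal x∈ z∈ Rxz)))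
    where
    weight-on-relation : ∀ i → E8Rel i x z → nonOrthogonal i * dot z x ≡ dot z x
    weight-on-relation zero _ = ℤP.*-identityˡ (dot z x)
    weight-on-relation (suc zero) _ = ℤP.*-identityˡ (dot z x)
    weight-on-relation (suc (suc zero)) x⊥z = sym (trans (dot-comm z x) x⊥z)
    weight-on-relation (suc (suc (suc zero))) _ = ℤP.*-identityˡ (dot z x)

  Φ : ℤ⁸ → ℤ⁸ → ℤ
  Φ x y = ∑ X λ z → ⟦ nonOrthogonal ⟧ x z * dot z y

  Ψ : ℤ⁸ → ℤ
  Ψ y = ∑ X λ z → dot z y

  Φ-+ʳ : ∀ x u v → Φ x (u +ᵥ v) ≡ Φ x u + Φ x v
  Φ-+ʳ x u v = trans (∑-cong X (λ {z} _ → trans (cong (⟦ nonOrthogonal ⟧ x z *_) (dot-+ʳ z u v))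
                                                 (ℤP.*-distribˡ-+ (⟦ nonOrthogonal ⟧ x z) (dot z u) (dot z v))))
                     (∑-+ X _ _)

  Φ-negʳ : ∀ x u → Φ x (neg u) ≡ - Φ x u
  Φ-negʳ x u = trans (∑-cong X (λ {z} _ → trans (cong (⟦ nonOrthogonal ⟧ x z *_) (dot-negʳ z u))
                                               (sym (ℤP.neg-distribʳ-* (⟦ nonOrthogonal ⟧ x z) (dot z u)))))
                     (∑-neg X _)

  Ψ-+ : ∀ u v → Ψ (u +ᵥ v) ≡ Ψ u + Ψ v
  Ψ-+ u v = trans (∑-cong X (λ {z} _ → dot-+ʳ z u v)) (∑-+ X _ _)

  Ψ-neg : ∀ u → Ψ (neg u) ≡ - Ψ u
  Ψ-neg u = trans (∑-cong X (λ {z} _ → dot-negʳ z u)) (∑-neg X _)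

  Φ-invariant : ∀ {k x y x′ y′} → x ∈ X → y ∈ X → x′ ∈ X → y′ ∈ X → E8Rel k x y → E8Rel k x′ y′ →
                Φ x y ≡ Φ x′ y′
  Φ-invariant {k} {x} {y} {x′} {y′} x∈ y∈ x′∈ y′∈ Rxy Rx′y′ = begin
    Φ x y                                                ≡⟨ ∑-cong X (λ {z} z∈ → cong (⟦ nonOrthogonal ⟧ x z *_) (dot≡⟦gram⟧ y∈ z∈)) ⟩
    ∑ X (λ z → ⟦ nonOrthogonal ⟧ x z * ⟦ gram ⟧ z y)     ≡⟨ ∑-⟦⟧*⟦⟧-invariant scheme nonOrthogonal gram x∈ y∈ x′∈ y′∈ Rxy Rx′y′ ⟩
    ∑ X (λ z → ⟦ nonOrthogonal ⟧ x′ z * ⟦ gram ⟧ z y′)   ≡⟨ ∑-cong X (λ {z} z∈ → cong (⟦ nonOrthogonal ⟧ x′ z *_) (dot≡⟦gram⟧ y′∈ z∈)) ⟨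
    Φ x′ y′                                              ∎

  Ψ≡Φ-diagonal : ∀ {x} → x ∈ X → Ψ x ≡ Φ x x
  Ψ≡Φ-diagonal x∈ = ∑-cong X (dot≡⟦nonOrthogonal⟧*dot x∈)

  -- Uses the roots e₃+e₄ + e₅-e₃ = e₄+e₅, all orthogonal to e₁+e₂.
  constant-on-⊥-representatives⇒0 :
    ∀ (f : ℤ⁸ → ℤ) → (∀ u v → f (u +ᵥ v) ≡ f u + f v) → (∀ u → f (neg u) ≡ - f u) → ∀ {c} →
    (∀ {r s} → IsE8Root r → dot e₁+e₂ r ≡ 0ℤ → signedᵥ s r ∈ X → f (signedᵥ s r) ≡ c) → c ≡ 0ℤ
  constant-on-⊥-representatives⇒0 f f-+ f-neg {c} constant =
    let s₁ , fu = on-representative (from-yes (isE8Root? e₃+e₄)) refl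
        s₂ , fv = on-representative (from-yes (isE8Root? e₅-e₃)) refl
        s₃ , fw = on-representative (from-yes (isE8Root? e₄+e₅)) refl
    in OddAdditive.signed-constant-on-sum⇒0 f f-+ f-neg s₁ s₂ s₃ {e₃+e₄} {e₅-e₃} fu fv fw
    where
    on-representative : ∀ {r} → IsE8Root r → dot e₁+e₂ r ≡ 0ℤ → ∃[ s ] f (signedᵥ s r) ≡ c
    on-representative r-root r⊥ = let s , r∈ = representative r-root in s , constant {s = s} r-root r⊥ r∈

  Φ-diagonal≡0 : ∀ {x} → x ∈ X → Φ x x ≡ 0ℤ
  Φ-diagonal≡0 x∈ = constant-on-⊥-representatives⇒0 Ψ Ψ-+ Ψ-neg
    (λ _ _ r∈ → trans (Ψ≡Φ-diagonal r∈) (Φ-invariant {k = zero} r∈ r∈ x∈ x∈ refl refl))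

  module _ {s₀} (x∈ : signedᵥ s₀ e₁+e₂ ∈ X) where

    x : ℤ⁸
    x = signedᵥ s₀ e₁+e₂

    open OddAdditive (Φ x) (Φ-+ʳ x) (Φ-negʳ x) using (f-signed)

    Φ-⊥≡0 : ∀ {r} → IsE8Root r → dot e₁+e₂ r ≡ 0ℤ → Φ x r ≡ 0ℤ
    Φ-⊥≡0 {r} r-root r⊥ =
      let s , r∈ = representative r-root
          Φ-representative≡0 = constant-on-⊥-representatives⇒0 (Φ x) (Φ-+ʳ x) (Φ-negʳ x)
            (λ {_} {s′} _ r′⊥ r′∈ →
              Φ-invariant {k = suc (suc zero)} x∈ r′∈ x∈ r∈ (dot-signed-⊥ s₀ s′ r′⊥) (dot-signed-⊥ s₀ s r⊥))
      in signed≡0 s (trans (sym (f-signed s r)) Φ-representative≡0)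

    Φ-e₁+e₂≡0 : Φ x e₁+e₂ ≡ 0ℤ
    Φ-e₁+e₂≡0 = begin
      Φ x e₁+e₂                   ≡⟨ cong (Φ x) (signedᵥ-involutive s₀ e₁+e₂) ⟨
      Φ x (signedᵥ s₀ x)          ≡⟨ f-signed s₀ x ⟩
      signed s₀ (Φ x x)           ≡⟨ cong (signed s₀) (Φ-diagonal≡0 x∈) ⟩
      signed s₀ 0ℤ                ≡⟨ signed-zero s₀ ⟩
      0ℤ                          ∎

    Φ-e₁+e₃≡0 : Φ x e₁+e₃ ≡ 0ℤ
    Φ-e₁+e₃≡0 = double≡0 (begin
      Φ x e₁+e₃ + Φ x e₁+e₃                               ≡⟨ Φ-+ʳ x e₁+e₃ e₁+e₃ ⟨
      Φ x (e₁+e₃ +ᵥ e₁+e₃)                                ≡⟨⟩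
      Φ x (((e₁+e₂ +ᵥ e₁-e₂) +ᵥ e₃+e₄) +ᵥ e₃-e₄)           ≡⟨ Φ-+ʳ x _ e₃-e₄ ⟩
      Φ x ((e₁+e₂ +ᵥ e₁-e₂) +ᵥ e₃+e₄) + Φ x e₃-e₄          ≡⟨ cong (_+ Φ x e₃-e₄) (Φ-+ʳ x _ e₃+e₄) ⟩
      Φ x (e₁+e₂ +ᵥ e₁-e₂) + Φ x e₃+e₄ + Φ x e₃-e₄         ≡⟨ cong (λ a → a + Φ x e₃+e₄ + Φ x e₃-e₄) (Φ-+ʳ x e₁+e₂ e₁-e₂) ⟩
      Φ x e₁+e₂ + Φ x e₁-e₂ + Φ x e₃+e₄ + Φ x e₃-e₄        ≡⟨ cong₂ _+_ (cong₂ _+_ (cong₂ _+_ Φ-e₁+e₂≡0 (Φ-⊥≡0 (from-yes (isE8Root? e₁-e₂)) refl))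
                                                                                  (Φ-⊥≡0 (from-yes (isE8Root? e₃+e₄)) refl))
                                                                   (Φ-⊥≡0 (from-yes (isE8Root? e₃-e₄)) refl) ⟩
      0ℤ                                                  ∎)

    8∣Φ-e₁+e₃-4*29 : + 8 ∣ Φ x e₁+e₃ - + 4 * + 29
    8∣Φ-e₁+e₃-4*29 = subst (+ 8 ∣_) ∑-term (∑-∣ X term 8∣term)
      where
      term : ℤ⁸ → ℤ
      term z = ⟦ nonOrthogonal ⟧ x z * dot z e₁+e₃ - + 4 * antipodalMultiplicity contributingPairs z
      8∣term : ∀ {z} → z ∈ X → + 8 ∣ term z
      8∣term z∈ with All.lookup (congruent-on-roots s₀) (∈-roots (X-roots z∈))
      ... | inj₁ refl = ⊥-elim (neg∉X x∈ z∈)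
      ... | inj₂ 8∣ = 8∣
      ∑-term : ∑ X term ≡ Φ x e₁+e₃ - + 4 * + 29
      ∑-term = begin
        ∑ X term                                                                 ≡⟨ ∑-- X _ _ ⟩
        Φ x e₁+e₃ - ∑ X (λ z → + 4 * antipodalMultiplicity contributingPairs z)  ≡⟨ cong (_-_ (Φ x e₁+e₃)) (∑-*ˡ X (+ 4) _) ⟩
        Φ x e₁+e₃ - + 4 * ∑ X (antipodalMultiplicity contributingPairs)          ≡⟨ cong (λ a → Φ x e₁+e₃ - + 4 * a)
                                                                                       (∑-antipodalMultiplicity (from-yes (all? isE8Root? contributingPairs))) ⟩
        Φ x e₁+e₃ - + 4 * + 29                                                   ∎

proposition2p4 : (X : List (Vec ℤ 8)) → IsAntipodalHalf X →
                 ¬ IsAssociationScheme X 3 E8Rel E8Rel?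
proposition2p4 X antipodalHalf scheme =
  let s₀ , x∈ = representative (from-yes (isE8Root? e₁+e₂))
  in 8∤0-4*29 (subst (λ a → + 8 ∣ a - + 4 * + 29) (Φ-e₁+e₃≡0 {s₀} x∈) (8∣Φ-e₁+e₃-4*29 {s₀} x∈))
  where
  open Consequences X antipodalHalf scheme
  8∤0-4*29 : ¬ (+ 8 ∣ 0ℤ - + 4 * + 29)
  8∤0-4*29 = from-no (+ 8 ∣? 0ℤ - + 4 * + 29)
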